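{- Let $q\ge0$ and let $D\subseteq E(\triangle_q)$. (A) If $\triangle_q-D$ is connected, then $\mathrm{dist}_{\triangle_q-D}(\sigma,x)\le q+|D|+1$ for all $x\in V(\triangle_q)$. (B) If $\triangle_q-D$ has exactly two connected components, with $\sigma$ and $\tau$ in different components, then $\min_{z\in\{\sigma,\tau\}}\mathrm{dist}_{\triangle_q-D}(z,x)\le q+|D|-1$ for all $x\in V(\triangle_q)$.
   Context: The $q$-triangle fractal $\triangle_q$ is built as follows: start with two vertices $\sigma,\tau$ joined by one edge, which is marked. Then repeat $q$ times: for every currently marked edge $\{a,b\}$ add a new vertex $w$ and the two new edges $\{a,w\},\{w,b\}$, mark these new edges, and unmark all previously marked edges. Distances are numbers of edges on shortest paths (infinite if no path exists). -}

module Defs where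

open import Data.Nat using (ℕ; zero; suc; _+_; _∸_; _<_; _≤_)
open import Data.Product using (_×_; _,_; ∃; proj₁; proj₂)
open import Data.Sum using (_⊎_)
open import Data.List using (List; []; _∷_; _++_; length; [_])
open import Data.Fin using (Fin)
open import Data.Fin.Subset using (Subset; _∉_; ∣_∣)
open import Data.List.Base using (lookup)
open import Relation.Binary.PropositionalEquality using (_≡_)
open import Relation.Nullary using (¬_)

-- An edge {a,b} is stored as an ordered pair (a , b); vertices are natural
-- numbers, labelled in the order of creation.
Edge : Set
Edge = ℕ × ℕ

-- State of the construction: number of vertices created so far (vertices are
-- 0 .. nv-1), list of all edges, list of currently marked edges.
record State : Set where
  constructor st
  field
    nv     : ℕ
    edges  : List Edge
    marked : List Edge
open State public

subdivide : ℕ → List Edge → List Edge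
subdivide n [] = []
subdivide n ((a , b) ∷ es) = (a , n) ∷ (n , b) ∷ subdivide (suc n) es

step : State → State
step (st n es ms) = st (n + length ms) (es ++ subdivide n ms) (subdivide n ms)

-- Start: vertices σ = 0 and τ = 1, one marked edge {σ,τ}.
initial : State
initial = st 2 [ (0 , 1) ] [ (0 , 1) ]

tri : ℕ → State
tri zero = initial
tri (suc q) = step (tri q)

σ τ : ℕ
σ = 0
τ = 1

nV : ℕ → ℕ
nV q = nv (tri q)

nE : ℕ → ℕ
nE q = length (edges (tri q))

edgeOf : (q : ℕ) → Fin (nE q) → Edge
edgeOf q i = lookup (edges (tri q)) i

Joins : Edge → ℕ → ℕ → Set
Joins (a , b) x y = (a ≡ x × b ≡ y) ⊎ (a ≡ y × b ≡ x)

-- Walk q D x y k : a walk of length k from x to y in △_q - D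
-- (D ⊆ E(△_q) given as a subset of the edge indices).
data Walk (q : ℕ) (D : Subset (nE q)) : ℕ → ℕ → ℕ → Set where
  nil  : ∀ {x} → Walk q D x x 0
  cons : ∀ {x y z k} (e : Fin (nE q)) → e ∉ D → Joins (edgeOf q e) x y →
         Walk q D y z k → Walk q D x z (suc k)

Conn : (q : ℕ) → Subset (nE q) → ℕ → ℕ → Set
Conn q D x y = ∃ λ k → Walk q D x y k

DistLe : (q : ℕ) → Subset (nE q) → ℕ → ℕ → ℕ → Set
DistLe q D x y k = ∃ λ l → l ≤ k × Walk q D x y l

Connected : (q : ℕ) → Subset (nE q) → Set
Connected q D = ∀ x y → x < nV q → y < nV q → Conn q D x y

TwoComponents : (q : ℕ) → Subset (nE q) → Set
TwoComponents q D = ¬ Conn q D σ τ × (∀ x → x < nV q → Conn q D σ x ⊎ Conn q D τ x)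

module Submission where

-- Proof idea.  △_q is grown one vertex at a time: subdividing an edge ab by a
-- fresh vertex N whose level (the round in which it is created) exceeds the
-- levels of a and b.  We prove, for every such graph and every deletion R of c
-- of its edges, the bounds of the theorem with q replaced by the level of the
-- target vertex x:  dist(σ,x) < lev x + c + 2 if R is connected, and
-- min(dist(σ,x), dist(τ,x)) < lev x + c if R has exactly two components
-- separating σ from τ  (the predicate 'Good').
-- For the subdivision step, every deletion R' of the new graph is 'simulated'
-- by a deletion RG of the old graph with at most as many deleted edges
-- (restoring ab when both halves a–N, N–b survive but ab was deleted):
-- contracting N onto a neighbour turns R'-walks between old vertices into
-- RG-walks, RG-walks get at most δ longer in R', and N itself is reached via a
-- surviving neighbour of lower level or is isolated, which the hypotheses
-- exclude.

open import Defs
open import Data.Nat using (ℕ; zero; suc; _+_; _∸_; _<_; _≤_; z≤n; s≤s; _≟_; _<?_)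
open import Data.Nat.Properties
open import Data.Product using (_×_; _,_; ∃; proj₁; proj₂)
import Data.Product as Product
open import Data.Product.Properties using (≡-dec; ,-injectiveˡ)
open import Data.Sum using (_⊎_; inj₁; inj₂)
import Data.Sum as Sum
open import Data.Fin using (Fin; zero; suc)
open import Data.Fin.Subset using (Subset; ∣_∣) renaming (_∉_ to _∉ₛ_)
open import Data.Bool using (true; false)
open import Data.Vec using ([]; _∷_; here; there)
open import Data.List using (List; []; _∷_; _++_; length)
open import Data.List.Base using (lookup)
open import Data.List.Properties using (++-assoc; ++-identityʳ)
open import Data.List.Relation.Unary.Any using (here; there)
open import Data.List.Membership.Propositional using (_∈_; _∉_)
open import Data.List.Membership.Propositional.Properties using (∈-++⁻; ∈-++⁺ˡ; ∈-++⁺ʳ)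
open import Data.List.Membership.DecPropositional {A = Edge} (≡-dec _≟_ _≟_) using (_∈?_)
open import Data.List.Relation.Binary.Subset.Propositional using (_⊆_)
open import Data.List.Relation.Binary.Subset.Propositional.Properties using (xs⊆xs++ys; xs⊆ys++xs)
open import Data.Empty using (⊥; ⊥-elim)
open import Relation.Nullary using (¬_; yes; no)
open import Relation.Binary.PropositionalEquality

data WalkIn (R : List Edge) : ℕ → ℕ → ℕ → Set where
  nil  : ∀ {x} → WalkIn R x x 0
  cons : ∀ {x y z k} (e : Edge) → e ∈ R → Joins e x y → WalkIn R y z k → WalkIn R x z (suc k)

ConnIn : List Edge → ℕ → ℕ → Set
ConnIn R x y = ∃ λ k → WalkIn R x y k

DistIn : List Edge → ℕ → ℕ → ℕ → Set
DistIn R x y b = ∃ λ l → l ≤ b × WalkIn R x y l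

Near : List Edge → ℕ → ℕ → ℕ → Set
Near R x y b = ∃ λ l → l < b × WalkIn R x y l

Joins-sym : ∀ {e x y} → Joins e x y → Joins e y x
Joins-sym (inj₁ (p , q)) = inj₂ (p , q)
Joins-sym (inj₂ (p , q)) = inj₁ (p , q)

weaken : ∀ {R S x y k} → R ⊆ S → WalkIn R x y k → WalkIn S x y k
weaken R⊆S nil = nil
weaken R⊆S (cons e e∈ j w) = cons e (R⊆S e∈) j (weaken R⊆S w)

append : ∀ {R x y z k l} → WalkIn R x y k → WalkIn R y z l → WalkIn R x z (k + l)
append nil w = w
append (cons e e∈ j w₁) w = cons e e∈ j (append w₁ w)

reverse : ∀ {R x y k} → WalkIn R x y k → ConnIn R y x
reverse nil = 0 , nil
reverse (cons e e∈ j w) with reverse w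
... | k , w′ = k + 1 , append w′ (cons e e∈ (Joins-sym j) nil)

Near-mono : ∀ {R x y b b′} → b ≤ b′ → Near R x y b → Near R x y b′
Near-mono b≤b′ (l , l< , w) = l , <-≤-trans l< b≤b′ , w

Linked : List Edge → ℕ → ℕ → Set
Linked S u w = u ≡ w ⊎ ∃ λ e → e ∈ S × Joins e u w

Linked-sym : ∀ {S u w} → Linked S u w → Linked S w u
Linked-sym (inj₁ eq) = inj₁ (sym eq)
Linked-sym (inj₂ (e , e∈ , j)) = inj₂ (e , e∈ , Joins-sym j)

-- A vertex map sending every edge of R to a loop or an edge of S maps
-- R-walks to S-walks; this is how walks are projected along a contraction.
EdgeMap : (ℕ → ℕ) → List Edge → List Edge → Set
EdgeMap f R S = ∀ {e u w} → e ∈ R → Joins e u w → Linked S (f u) (f w)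

project : ∀ {f R S x y k} → EdgeMap f R S → WalkIn R x y k → ConnIn S (f x) (f y)
project F nil = 0 , nil
project {f} {S = S} {y = y} F (cons e e∈ j w) with F e∈ j | project F w
... | inj₁ eq | conn = subst (λ v → ConnIn S v (f y)) (sym eq) conn
... | inj₂ (e′ , e′∈ , j′) | k , w′ = suc k , cons e′ e′∈ j′ w′

source : ∀ {a b x y} → Joins (a , b) x y → x ≡ a ⊎ x ≡ b
source (inj₁ (p , _)) = inj₁ (sym p)
source (inj₂ (_ , p)) = inj₂ (sym p)

target : ∀ {a b x y} → Joins (a , b) x y → y ≡ a ⊎ y ≡ b
target (inj₁ (_ , p)) = inj₂ (sym p)
target (inj₂ (p , _)) = inj₁ (sym p)

-- A walk in (a , b) ∷ R either avoids ab, or splits as x ⇝ u –ab– ... –ab– v ⇝ z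
-- at the first and the last use of ab (u, v ∈ {a, b}), the two ends lying in R.
record Detour (R : List Edge) (a b x z l : ℕ) : Set where
  constructor detour
  field
    {u v l₁ l₂} : ℕ
    u-end   : u ≡ a ⊎ u ≡ b
    v-end   : v ≡ a ⊎ v ≡ b
    before  : WalkIn R x u l₁
    after   : WalkIn R v z l₂
    shorter : suc (l₁ + l₂) ≤ l

firstLastUse : ∀ {a b R x z l} → WalkIn ((a , b) ∷ R) x z l → WalkIn R x z l ⊎ Detour R a b x z l
firstLastUse nil = inj₁ nil
firstLastUse (cons e (here refl) j rest) with firstLastUse rest
... | inj₁ w = inj₂ (detour (source j) (target j) nil w ≤-refl)
... | inj₂ (detour {l₁ = l₁} {l₂} _ v-end _ after shorter) =
  inj₂ (detour (source j) v-end nil after (s≤s (≤-trans (m≤n+m l₂ l₁) (<⇒≤ shorter))))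
firstLastUse (cons e (there e∈) j rest) with firstLastUse rest
... | inj₁ w = inj₁ (cons e e∈ j w)
... | inj₂ (detour u-end v-end before after shorter) =
  inj₂ (detour u-end v-end (cons e e∈ j before) after (s≤s shorter))

data Removal : List Edge → List Edge → ℕ → Set where
  done : Removal [] [] 0
  keep : ∀ {e es R c} → Removal es R c → Removal (e ∷ es) (e ∷ R) c
  drop : ∀ {e es R c} → Removal es R c → Removal (e ∷ es) R (suc c)

removal-⊆ : ∀ {es R c} → Removal es R c → R ⊆ es
removal-⊆ (keep r) (here p) = here p
removal-⊆ (keep r) (there e∈) = there (removal-⊆ r e∈)
removal-⊆ (drop r) e∈ = there (removal-⊆ r e∈)

record SplitRemoval (es es′ R : List Edge) (c : ℕ) : Set where
  constructor split
  field
    {R₁ R₂} : List Edge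
    {c₁ c₂} : ℕ
    left  : Removal es R₁ c₁
    right : Removal es′ R₂ c₂
    R≡    : R ≡ R₁ ++ R₂
    c≡    : c ≡ c₁ + c₂

removal-++ : ∀ es {es′ R c} → Removal (es ++ es′) R c → SplitRemoval es es′ R c
removal-++ [] r = split done r refl refl
removal-++ (e ∷ es) (keep r) with removal-++ es r
... | split r₁ r₂ refl refl = split (keep r₁) r₂ refl refl
removal-++ (e ∷ es) (drop r) with removal-++ es r
... | split r₁ r₂ refl refl = split (drop r₁) r₂ refl refl

record Reinsertion (es R : List Edge) (c : ℕ) (e : Edge) : Set where
  constructor reinsertion
  field
    {R*} : List Edge
    {c*} : ℕ
    c≡      : c ≡ suc c*
    removal : Removal es R* c*
    grows   : R ⊆ R*
    e∈R*    : e ∈ R*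
    only-e  : R* ⊆ e ∷ R

reinsert : ∀ {es R c e} → Removal es R c → e ∈ es → e ∉ R → Reinsertion es R c e
reinsert done () e∉
reinsert (keep r) (here p) e∉ = ⊥-elim (e∉ (here p))
reinsert (keep {e₀} r) (there e∈) e∉ with reinsert r e∈ (λ m → e∉ (there m))
... | reinsertion refl r* grows e∈R* only-e =
  reinsertion refl (keep r*) grows′ (there e∈R*) only-e′
  where
    grows′ : e₀ ∷ _ ⊆ e₀ ∷ _
    grows′ (here p) = here p
    grows′ (there m) = there (grows m)
    only-e′ : e₀ ∷ _ ⊆ _ ∷ e₀ ∷ _
    only-e′ (here p) = there (here p)
    only-e′ (there m) with only-e m
    ... | here p = here p
    ... | there m′ = there (there m′)
reinsert (drop r) (here refl) e∉ = reinsertion refl (keep r) there (here refl) (λ m → m)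
reinsert (drop r) (there e∈) e∉ with reinsert r e∈ e∉
... | reinsertion refl r* grows e∈R* only-e = reinsertion refl (drop r*) grows e∈R* only-e

Bounded : List Edge → ℕ → Set
Bounded es N = ∀ {a b} → (a , b) ∈ es → a < N × b < N

record WellFormed (es : List Edge) (N : ℕ) : Set where
  field
    bounded : Bounded es N
    στ∈     : (σ , τ) ∈ es

  σ<N : σ < N
  σ<N = proj₁ (bounded στ∈)

  τ<N : τ < N
  τ<N = proj₂ (bounded στ∈)

joins-bounded : ∀ {es N e u w} → Bounded es N → e ∈ es → Joins e u w → u < N × w < N
joins-bounded bd e∈ (inj₁ (refl , refl)) = bd e∈
joins-bounded bd e∈ (inj₂ (refl , refl)) = Product.swap (bd e∈)

ConnectedIn : List Edge → ℕ → Set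
ConnectedIn R N = ∀ x y → x < N → y < N → ConnIn R x y

TwoComponentsIn : List Edge → ℕ → Set
TwoComponentsIn R N = ¬ ConnIn R σ τ × (∀ x → x < N → ConnIn R σ x ⊎ ConnIn R τ x)

BoundA : List Edge → ℕ → ℕ → (ℕ → ℕ) → Set
BoundA R N c lev = ConnectedIn R N → ∀ x → x < N → Near R σ x (2 + (lev x + c))

BoundB : List Edge → ℕ → ℕ → (ℕ → ℕ) → Set
BoundB R N c lev = TwoComponentsIn R N → ∀ x → x < N → Near R σ x (lev x + c) ⊎ Near R τ x (lev x + c)

Good : List Edge → ℕ → (ℕ → ℕ) → Set
Good es N lev = ∀ {R c} → Removal es R c → BoundA R N c lev × BoundB R N c lev

good-mono : ∀ {es N lev lev′} → (∀ x → x < N → lev x ≤ lev′ x) → Good es N lev → Good es N lev′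
good-mono {lev = lev} {lev′} lev≤ G {c = c} r = boundA , boundB
  where
    raise : ∀ s x → x < _ → s + (lev x + c) ≤ s + (lev′ x + c)
    raise s x x< = +-monoʳ-≤ s (+-monoˡ-≤ c (lev≤ x x<))
    boundA : BoundA _ _ c lev′
    boundA conn x x< = Near-mono (raise 2 x x<) (proj₁ (G r) conn x x<)
    boundB : BoundB _ _ c lev′
    boundB two x x< = Sum.map (Near-mono (raise 0 x x<)) (Near-mono (raise 0 x x<)) (proj₂ (G r) two x x<)

spend : ∀ s m {g d c l l′} → l < s + (m + g) → l′ ≤ l + d → g + d ≤ c → l′ < s + (m + c)
spend s m {g} {d} {c} {l} {l′} l< l′≤ g+d≤c = begin-strict
  l′                  ≤⟨ l′≤ ⟩
  l + d               <⟨ +-monoˡ-< d l< ⟩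
  s + (m + g) + d     ≡⟨ trans (+-assoc s (m + g) d) (cong (s +_) (+-assoc m g d)) ⟩
  s + (m + (g + d))   ≤⟨ +-monoʳ-≤ s (+-monoʳ-≤ m g+d≤c) ⟩
  s + (m + c)         ∎
  where open ≤-Reasoning

spend-step : ∀ s m n {g d c l l′} → l < s + (m + g) → l′ ≤ l + d → g + d ≤ c → m < n →
  l′ + 1 < s + (n + c)
spend-step s m n {c = c} {l′ = l′} l< l′≤ g+d≤c m<n = begin-strict
  l′ + 1              ≡⟨ +-comm l′ 1 ⟩
  suc l′              ≤⟨ spend s m l< l′≤ g+d≤c ⟩
  s + (m + c)         <⟨ +-monoʳ-< s (+-monoˡ-< c m<n) ⟩
  s + (n + c)         ∎
  where open ≤-Reasoning

wellFormed-subdivide : ∀ {es N a b} → WellFormed es N → a < N → b < N →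
  WellFormed (es ++ (a , N) ∷ (N , b) ∷ []) (suc N)
wellFormed-subdivide {es} wf a<N b<N = record { bounded = bounded′ ; στ∈ = ∈-++⁺ˡ στ∈ }
  where
    open WellFormed wf
    bounded′ : Bounded (es ++ _) _
    bounded′ e∈ with ∈-++⁻ es e∈
    ... | inj₁ old = Product.map m<n⇒m<1+n m<n⇒m<1+n (bounded old)
    ... | inj₂ (here refl) = m<n⇒m<1+n a<N , n<1+n _
    ... | inj₂ (there (here refl)) = n<1+n _ , m<n⇒m<1+n b<N

module Subdivision {es N lev a b} (wf : WellFormed es N) (ab∈ : (a , b) ∈ es)
  (a< : lev a < lev N) (b< : lev b < lev N) (G : Good es N lev) where

  open WellFormed wf

  a<N : a < N
  a<N = proj₁ (bounded ab∈)

  b<N : b < N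
  b<N = proj₂ (bounded ab∈)

  e₁ e₂ : Edge
  e₁ = (a , N)
  e₂ = (N , b)

  new : List Edge
  new = e₁ ∷ e₂ ∷ []

  old-avoids-N : ∀ {R c d} → Removal es R c → (N , d) ∉ R × (d , N) ∉ R
  old-avoids-N r = (λ m → <-irrefl refl (proj₁ (bounded (removal-⊆ r m))))
                 , (λ m → <-irrefl refl (proj₂ (bounded (removal-⊆ r m))))

  -- A walk using the edge ab is rerouted along a–N–b, costing one extra edge
  -- in total (only the first and last use of ab matter).
  bypass : ∀ {R R′ x y l} → R ⊆ R′ → e₁ ∈ R′ → e₂ ∈ R′ →
    WalkIn ((a , b) ∷ R) x y l → DistIn R′ x y (l + 1)
  bypass {l = l} R⊆R′ e₁∈ e₂∈ w with firstLastUse w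
  ... | inj₁ w′ = l , m≤m+n l 1 , weaken R⊆R′ w′
  ... | inj₂ (detour {l₁ = l₁} {l₂} u-end v-end before after shorter) =
    l₁ + (1 + (1 + l₂)) , length≤ ,
    append (weaken R⊆R′ before) (append (toN u-end) (append (fromN v-end) (weaken R⊆R′ after)))
    where
      toN : ∀ {u} → u ≡ a ⊎ u ≡ b → WalkIn _ u N 1
      toN (inj₁ refl) = cons e₁ e₁∈ (inj₁ (refl , refl)) nil
      toN (inj₂ refl) = cons e₂ e₂∈ (inj₂ (refl , refl)) nil
      fromN : ∀ {v} → v ≡ a ⊎ v ≡ b → WalkIn _ N v 1
      fromN (inj₁ refl) = cons e₁ e₁∈ (inj₂ (refl , refl)) nil
      fromN (inj₂ refl) = cons e₂ e₂∈ (inj₁ (refl , refl)) nil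
      length≤ : l₁ + (1 + (1 + l₂)) ≤ l + 1
      length≤ = begin
        l₁ + suc (suc l₂)    ≡⟨ trans (+-suc l₁ (suc l₂)) (cong suc (+-suc l₁ l₂)) ⟩
        suc (suc (l₁ + l₂))  ≤⟨ s≤s shorter ⟩
        suc l                ≡⟨ +-comm 1 l ⟩
        l + 1                ∎
        where open ≤-Reasoning

  -- A deletion R′ (c′ edges) of the subdivided graph is simulated by a deletion
  -- RG (cG edges) of the old graph: R′ consists of edges of RG and new edges,
  -- the path a–N–b in R′ is matched by ab in RG, and RG-walks lengthen by at
  -- most δ in R′, where cG + δ ≤ c′.
  record Simulation (R′ : List Edge) (c′ : ℕ) : Set where
    field
      {RG}     : List Edge
      {cG δ}   : ℕ
      removal  : Removal es RG cG
      classify : ∀ {e} → e ∈ R′ → e ∈ RG ⊎ e ∈ new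
      shortcut : e₁ ∈ R′ → e₂ ∈ R′ → (a , b) ∈ RG
      lift     : ∀ {x y l} → WalkIn RG x y l → DistIn R′ x y (l + δ)
      cost     : cG + δ ≤ c′

  record OldNeighbour (R′ : List Edge) : Set where
    field
      {v}    : ℕ
      {e}    : Edge
      v<N    : v < N
      lower  : lev v < lev N
      e∈     : e ∈ R′
      joins  : Joins e v N

  contract : ℕ → ℕ → ℕ
  contract h x with x ≟ N
  ... | yes _ = h
  ... | no _ = x

  contract-old : ∀ {h x} → x < N → contract h x ≡ x
  contract-old {x = x} x<N with x ≟ N
  ... | yes refl = ⊥-elim (<-irrefl refl x<N)
  ... | no _ = refl

  contract-new : ∀ {h} → contract h N ≡ h
  contract-new with N ≟ N
  ... | yes _ = refl
  ... | no N≢N = ⊥-elim (N≢N refl)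

  module Simulated {R′ c′} (S : Simulation R′ c′) where
    open Simulation S

    bounded-RG : Bounded RG N
    bounded-RG m = bounded (removal-⊆ removal m)

    contraction : ∀ h → (e₁ ∈ R′ → Linked RG a h) → (e₂ ∈ R′ → Linked RG h b) →
      EdgeMap (contract h) R′ RG
    contraction h on-e₁ on-e₂ {e} {u} {w} e∈ j with classify e∈
    ... | inj₁ old = inj₂ (e , old , subst₂ (Joins e) (sym (contract-old u<N)) (sym (contract-old w<N)) j)
      where
        u<N = proj₁ (joins-bounded bounded-RG old j)
        w<N = proj₂ (joins-bounded bounded-RG old j)
    ... | inj₂ (here refl) with j
    ...   | inj₁ (refl , refl) = subst₂ (Linked RG) (sym (contract-old a<N)) (sym contract-new) (on-e₁ e∈)
    ...   | inj₂ (refl , refl) = subst₂ (Linked RG) (sym contract-new) (sym (contract-old a<N))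
                                   (Linked-sym (on-e₁ e∈))
    contraction h on-e₁ on-e₂ {e} {u} {w} e∈ j | inj₂ (there (here refl)) with j
    ...   | inj₁ (refl , refl) = subst₂ (Linked RG) (sym contract-new) (sym (contract-old b<N)) (on-e₂ e∈)
    ...   | inj₂ (refl , refl) = subst₂ (Linked RG) (sym (contract-old b<N)) (sym contract-new)
                                   (Linked-sym (on-e₂ e∈))

    ab-linked : (a , b) ∈ RG → Linked RG a b
    ab-linked ab∈RG = inj₂ ((a , b) , ab∈RG , inj₁ (refl , refl))

    project-old : ∀ {x y} → x < N → y < N → ConnIn R′ x y → ConnIn RG x y
    project-old x<N y<N (_ , w) with e₁ ∈? R′
    ... | yes e₁∈ = subst₂ (ConnIn RG) (contract-old x<N) (contract-old y<N)
          (project (contraction a (λ _ → inj₁ refl) (λ e₂∈ → ab-linked (shortcut e₁∈ e₂∈))) w)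
    ... | no e₁∉ = subst₂ (ConnIn RG) (contract-old x<N) (contract-old y<N)
          (project (contraction b (λ e₁∈ → ⊥-elim (e₁∉ e₁∈)) (λ _ → inj₁ refl)) w)

    isolated : e₁ ∉ R′ → e₂ ∉ R′ → ∀ {y k} → WalkIn R′ N y k → y ≡ N
    isolated e₁∉ e₂∉ nil = refl
    isolated e₁∉ e₂∉ (cons e e∈ j w) with classify e∈
    ... | inj₁ old = ⊥-elim (<-irrefl refl (proj₁ (joins-bounded bounded-RG old j)))
    ... | inj₂ (here refl) = ⊥-elim (e₁∉ e∈)
    ... | inj₂ (there (here refl)) = ⊥-elim (e₂∉ e∈)

    attachment : OldNeighbour R′ ⊎ (∀ {y k} → WalkIn R′ N y k → y ≡ N)
    attachment with e₁ ∈? R′ | e₂ ∈? R′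
    ... | yes e₁∈ | _ = inj₁ (record { v<N = a<N ; lower = a< ; e∈ = e₁∈ ; joins = inj₁ (refl , refl) })
    ... | no _ | yes e₂∈ = inj₁ (record { v<N = b<N ; lower = b< ; e∈ = e₂∈ ; joins = inj₂ (refl , refl) })
    ... | no e₁∉ | no e₂∉ = inj₂ (isolated e₁∉ e₂∉)

    lift-near : ∀ s {z x} m → Near RG z x (s + (m + cG)) → Near R′ z x (s + (m + c′))
    lift-near s m (l , l< , w) with lift w
    ... | l′ , l′≤ , w′ = l′ , spend s m l< l′≤ cost , w′

    extend-near : ∀ s {z} (nb : OldNeighbour R′) → let open OldNeighbour nb in
      Near RG z v (s + (lev v + cG)) → Near R′ z N (s + (lev N + c′))
    extend-near s nb (l , l< , w) with lift w
    ... | l′ , l′≤ , w′ = l′ + 1 , spend-step s (lev v) (lev N) l< l′≤ cost lower ,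
                          append w′ (cons e e∈ joins nil)
      where open OldNeighbour nb

    lift-conn : ∀ {x y} → ConnIn RG x y → ConnIn R′ x y
    lift-conn (_ , w) with lift w
    ... | _ , _ , w′ = _ , w′

    connected-old : ConnectedIn R′ (suc N) → ConnectedIn RG N
    connected-old conn x y x<N y<N = project-old x<N y<N (conn x y (m<n⇒m<1+n x<N) (m<n⇒m<1+n y<N))

    two-old : TwoComponentsIn R′ (suc N) → TwoComponentsIn RG N
    two-old (apart , cover) =
      (λ c → apart (lift-conn c)) ,
      (λ x x<N → Sum.map (project-old σ<N x<N) (project-old τ<N x<N) (cover x (m<n⇒m<1+n x<N)))

    boundA : BoundA R′ (suc N) c′ lev
    boundA conn x x≤N with m<1+n⇒m<n∨m≡n x≤N | proj₁ (G removal) (connected-old conn)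
    ... | inj₁ x<N | old = lift-near 2 (lev x) (old x x<N)
    ... | inj₂ refl | old with attachment
    ...   | inj₁ nb = extend-near 2 nb (old _ (OldNeighbour.v<N nb))
    ...   | inj₂ stuck = ⊥-elim (<-irrefl (stuck (proj₂ (conn N σ (n<1+n N) (m<n⇒m<1+n σ<N)))) σ<N)

    boundB : BoundB R′ (suc N) c′ lev
    boundB two x x≤N with m<1+n⇒m<n∨m≡n x≤N | proj₂ (G removal) (two-old two)
    ... | inj₁ x<N | old = Sum.map (lift-near 0 (lev x)) (lift-near 0 (lev x)) (old x x<N)
    ... | inj₂ refl | old with attachment
    ...   | inj₁ nb = Sum.map (extend-near 0 nb) (extend-near 0 nb) (old _ (OldNeighbour.v<N nb))
    ...   | inj₂ stuck = ⊥-elim (Sum.[ escape σ<N , escape τ<N ] (proj₂ two N (n<1+n N)))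
      where
        escape : ∀ {z} → z < N → ConnIn R′ z N → ⊥
        escape z<N (_ , w) = <-irrefl (stuck (proj₂ (reverse w))) z<N

  -- Every deletion of the subdivided graph is simulated: by the deletion of
  -- the old edges it induces, or, when a–N and N–b survive but ab was deleted,
  -- by that deletion with ab restored (then δ = 1).
  simulate : ∀ {R₁ R₂ c₁ c₂} → Removal es R₁ c₁ → Removal new R₂ c₂ →
    Simulation (R₁ ++ R₂) (c₁ + c₂)
  simulate {R₁} {R₂} {c₁} {c₂} r₁ r₂ = cases r₂
    where
      induced : (e₁ ∈ R₁ ++ R₂ → e₂ ∈ R₁ ++ R₂ → (a , b) ∈ R₁) → Simulation (R₁ ++ R₂) (c₁ + c₂)
      induced shortcut = record
        { removal = r₁
        ; classify = λ e∈ → Sum.map₂ (removal-⊆ r₂) (∈-++⁻ R₁ e∈)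
        ; shortcut = shortcut
        ; lift = λ {_} {_} {l} w → l , m≤m+n l 0 , weaken (xs⊆xs++ys R₁ R₂) w
        ; cost = +-monoʳ-≤ c₁ z≤n }
      e₁∈R₂ : e₁ ∈ R₁ ++ R₂ → e₁ ∈ R₂
      e₁∈R₂ m = Sum.[ (λ m₁ → ⊥-elim (proj₂ (old-avoids-N r₁) m₁)) , (λ m₂ → m₂) ] (∈-++⁻ R₁ m)
      e₂∈R₂ : e₂ ∈ R₁ ++ R₂ → e₂ ∈ R₂
      e₂∈R₂ m = Sum.[ (λ m₁ → ⊥-elim (proj₁ (old-avoids-N r₁) m₁)) , (λ m₂ → m₂) ] (∈-++⁻ R₁ m)
      N≢a : N ≢ a
      N≢a N≡a = <-irrefl (sym N≡a) a<N
      cases : Removal new R₂ c₂ → Simulation (R₁ ++ R₂) (c₁ + c₂)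
      cases (keep (keep done)) with (a , b) ∈? R₁
      ... | yes ab∈R₁ = induced (λ _ _ → ab∈R₁)
      ... | no ab∉R₁ with reinsert r₁ ab∈ ab∉R₁
      ...   | reinsertion {c* = c*} refl r* grows e∈R* only-e = record
        { removal = r*
        ; classify = λ e∈ → Sum.map₁ grows (∈-++⁻ R₁ e∈)
        ; shortcut = λ _ _ → e∈R*
        ; lift = λ w → bypass (xs⊆xs++ys R₁ _) (∈-++⁺ʳ R₁ (here refl)) (∈-++⁺ʳ R₁ (there (here refl)))
                                (weaken only-e w)
        ; cost = ≤-reflexive (trans (+-comm c* 1) (sym (+-identityʳ (suc c*)))) }
      cases (keep (drop done)) = induced λ _ m → case-e₂ (e₂∈R₂ m)
        where
          case-e₂ : e₂ ∈ e₁ ∷ [] → _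
          case-e₂ (here eq) = ⊥-elim (N≢a (,-injectiveˡ eq))
      cases (drop (keep done)) = induced λ m _ → case-e₁ (e₁∈R₂ m)
        where
          case-e₁ : e₁ ∈ e₂ ∷ [] → _
          case-e₁ (here eq) = ⊥-elim (N≢a (sym (,-injectiveˡ eq)))
      cases (drop (drop done)) = induced λ m _ → case-e₁ (e₁∈R₂ m)
        where
          case-e₁ : e₁ ∈ [] → _
          case-e₁ ()

  subdivision-good : Good (es ++ new) (suc N) lev
  subdivision-good r with removal-++ es r
  ... | split r₁ r₂ refl refl = Simulated.boundA S , Simulated.boundB S
    where S = simulate r₁ r₂

roundLevel : ℕ → ℕ → ℕ → ℕ
roundLevel q n₀ x with x <? n₀
... | yes _ = q
... | no _ = suc q

roundLevel-old : ∀ q n₀ x → x < n₀ → roundLevel q n₀ x ≡ q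
roundLevel-old q n₀ x x< with x <? n₀
... | yes _ = refl
... | no x≮ = ⊥-elim (x≮ x<)

roundLevel-new : ∀ q n₀ x → n₀ ≤ x → roundLevel q n₀ x ≡ suc q
roundLevel-new q n₀ x n₀≤ with x <? n₀
... | yes x< = ⊥-elim (<-irrefl refl (<-≤-trans x< n₀≤))
... | no _ = refl

roundLevel≤ : ∀ q n₀ x → roundLevel q n₀ x ≤ suc q
roundLevel≤ q n₀ x with x <? n₀
... | yes _ = n≤1+n q
... | no _ = ≤-refl

Stage : List Edge → ℕ → (ℕ → ℕ) → Set
Stage es N lev = WellFormed es N × Good es N lev

subdivide-all : ∀ q n₀ ms {es N} → n₀ ≤ N → ms ⊆ es → Bounded ms n₀ →
  Stage es N (roundLevel q n₀) → Stage (es ++ subdivide N ms) (N + length ms) (roundLevel q n₀)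
subdivide-all q n₀ [] {es} {N} _ _ _ stage =
  subst₂ (λ es′ N′ → Stage es′ N′ (roundLevel q n₀)) (sym (++-identityʳ es)) (sym (+-identityʳ N)) stage
subdivide-all q n₀ ((a , b) ∷ ms) {es} {N} n₀≤N ms⊆ bounded-ms (wf , G) =
  subst₂ (λ es′ N′ → Stage es′ N′ (roundLevel q n₀)) (++-assoc es _ _) (sym (+-suc N (length ms))) rest
  where
    a<n₀ = proj₁ (bounded-ms (here refl))
    b<n₀ = proj₂ (bounded-ms (here refl))
    below-N : ∀ {x} → x < n₀ → roundLevel q n₀ x < roundLevel q n₀ N
    below-N {x} x< rewrite roundLevel-old q n₀ x x< | roundLevel-new q n₀ N n₀≤N = ≤-refl
    wf′ = wellFormed-subdivide wf (<-≤-trans a<n₀ n₀≤N) (<-≤-trans b<n₀ n₀≤N)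
    G′ = Subdivision.subdivision-good wf (ms⊆ (here refl)) (below-N a<n₀) (below-N b<n₀) G
    rest = subdivide-all q n₀ ms (m≤n⇒m≤1+n n₀≤N) (λ m → xs⊆xs++ys es _ (ms⊆ (there m)))
             (λ m → bounded-ms (there m)) (wf′ , G′)

record Invariant (q : ℕ) : Set where
  field
    wellFormed : WellFormed (edges (tri q)) (nV q)
    marked⊆    : marked (tri q) ⊆ edges (tri q)
    good       : Good (edges (tri q)) (nV q) (λ _ → q)

initial-good : Good ((σ , τ) ∷ []) 2 (λ _ → 0)
initial-good (keep done) = boundA , boundB
  where
    στ : WalkIn ((σ , τ) ∷ []) σ τ 1
    στ = cons (σ , τ) (here refl) (inj₁ (refl , refl)) nil
    boundA : BoundA _ 2 0 (λ _ → 0)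
    boundA _ zero _ = 0 , s≤s z≤n , nil
    boundA _ (suc zero) _ = 1 , s≤s (s≤s z≤n) , στ
    boundA _ (suc (suc _)) (s≤s (s≤s ()))
    boundB : BoundB _ 2 0 (λ _ → 0)
    boundB (apart , _) = ⊥-elim (apart (1 , στ))
initial-good (drop done) = boundA , boundB
  where
    boundA : BoundA [] 2 1 (λ _ → 0)
    boundA conn = ⊥-elim (no-walk (proj₂ (conn σ τ (s≤s z≤n) (s≤s (s≤s z≤n)))))
      where
        no-walk : ∀ {k} → WalkIn [] σ τ k → ⊥
        no-walk (cons _ () _ _)
    boundB : BoundB [] 2 1 (λ _ → 0)
    boundB _ zero _ = inj₁ (0 , s≤s z≤n , nil)
    boundB _ (suc zero) _ = inj₂ (0 , s≤s z≤n , nil)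
    boundB _ (suc (suc _)) (s≤s (s≤s ()))

invariant : ∀ q → Invariant q
invariant zero = record
  { wellFormed = record { bounded = λ { (here refl) → s≤s z≤n , s≤s (s≤s z≤n) } ; στ∈ = here refl }
  ; marked⊆ = λ m → m
  ; good = initial-good }
invariant (suc q) = record
  { wellFormed = proj₁ next
  ; marked⊆ = xs⊆ys++xs _ es
  ; good = good-mono (λ x _ → roundLevel≤ q n x) (proj₂ next) }
  where
    open Invariant (invariant q)
    n = nV q
    es = edges (tri q)
    start : Good es n (roundLevel q n)
    start = good-mono (λ x x< → ≤-reflexive (sym (roundLevel-old q n x x<))) good
    next = subdivide-all q n (marked (tri q)) ≤-refl marked⊆
             (λ m → WellFormed.bounded wellFormed (marked⊆ m)) (wellFormed , start)

kept : (es : List Edge) → Subset (length es) → List Edge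
kept [] [] = []
kept (e ∷ es) (true ∷ D) = kept es D
kept (e ∷ es) (false ∷ D) = e ∷ kept es D

kept-removal : ∀ es (D : Subset (length es)) → Removal es (kept es D) ∣ D ∣
kept-removal [] [] = done
kept-removal (e ∷ es) (true ∷ D) = drop (kept-removal es D)
kept-removal (e ∷ es) (false ∷ D) = keep (kept-removal es D)

lookup∈kept : ∀ es (D : Subset (length es)) i → i ∉ₛ D → lookup es i ∈ kept es D
lookup∈kept (e ∷ es) (true ∷ D) zero i∉ = ⊥-elim (i∉ here)
lookup∈kept (e ∷ es) (false ∷ D) zero i∉ = here refl
lookup∈kept (e ∷ es) (true ∷ D) (suc i) i∉ = lookup∈kept es D i (λ p → i∉ (there p))
lookup∈kept (e ∷ es) (false ∷ D) (suc i) i∉ = there (lookup∈kept es D i (λ p → i∉ (there p)))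

kept-index : ∀ es (D : Subset (length es)) {e} → e ∈ kept es D →
  ∃ λ (i : Fin (length es)) → i ∉ₛ D × lookup es i ≡ e
kept-index [] [] ()
kept-index (e₀ ∷ es) (true ∷ D) e∈ with kept-index es D e∈
... | i , i∉ , eq = suc i , (λ { (there p) → i∉ p }) , eq
kept-index (e₀ ∷ es) (false ∷ D) (here refl) = zero , (λ ()) , refl
kept-index (e₀ ∷ es) (false ∷ D) (there e∈) with kept-index es D e∈
... | i , i∉ , eq = suc i , (λ { (there p) → i∉ p }) , eq

toWalkIn : ∀ {q D x y k} → Walk q D x y k → WalkIn (kept (edges (tri q)) D) x y k
toWalkIn nil = nil
toWalkIn {q} {D} (cons i i∉ j w) = cons (edgeOf q i) (lookup∈kept (edges (tri q)) D i i∉) j (toWalkIn w)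

fromWalkIn : ∀ {q D x y k} → WalkIn (kept (edges (tri q)) D) x y k → Walk q D x y k
fromWalkIn nil = nil
fromWalkIn {q} {D} (cons e e∈ j w) with kept-index (edges (tri q)) D e∈
... | i , i∉ , refl = cons i i∉ j (fromWalkIn w)

lemma10 : (q : ℕ) (D : Subset (nE q)) →
    (Connected q D → ∀ x → x < nV q → DistLe q D σ x (q + ∣ D ∣ + 1))
    × (TwoComponents q D → ∀ x → x < nV q →
    DistLe q D σ x (q + ∣ D ∣ ∸ 1) ⊎ DistLe q D τ x (q + ∣ D ∣ ∸ 1))
lemma10 q D = boundA , boundB
  where
    R = kept (edges (tri q)) D
    bounds = Invariant.good (invariant q) (kept-removal (edges (tri q)) D)
    toConn : ∀ {x y} → Conn q D x y → ConnIn R x y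
    toConn (k , w) = k , toWalkIn w
    boundA : Connected q D → ∀ x → x < nV q → DistLe q D σ x (q + ∣ D ∣ + 1)
    boundA conn x x< with proj₁ bounds (λ x y x< y< → toConn (conn x y x< y<)) x x<
    ... | l , l< , w = l , ≤-trans (≤-pred l<) (≤-reflexive (+-comm 1 (q + ∣ D ∣))) , fromWalkIn w
    below : ∀ {z x} → Near R z x (q + ∣ D ∣) → DistLe q D z x (q + ∣ D ∣ ∸ 1)
    below (l , l< , w) = l , <⇒≤∸1 l< , fromWalkIn w
      where
        <⇒≤∸1 : ∀ {m n} → m < n → m ≤ n ∸ 1
        <⇒≤∸1 (s≤s m≤n) = m≤n
    boundB : TwoComponents q D → ∀ x → x < nV q →
      DistLe q D σ x (q + ∣ D ∣ ∸ 1) ⊎ DistLe q D τ x (q + ∣ D ∣ ∸ 1)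
    boundB (apart , cover) x x< =
      Sum.map below below
        (proj₂ bounds ((λ { (k , w) → apart (k , fromWalkIn w) }) ,
                       (λ y y< → Sum.map toConn toConn (cover y y<))) x x<)
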